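{- Let $m$ be a positive integer and $n=4m+1$ (i.e., the binary expansion of $n$ is that of $m$ followed by the digits $01$). Then \[ |H_8^{\nabla n}|=8\cdot|H_8^{\nabla m}|. \]
   Context: For nonempty finite sets $C=\{c_1,\ldots,c_s\}$, $D$ of positive integers, $C\mathbin{\nabla}D=c_1D\mathbin{\triangle}\cdots\mathbin{\triangle}c_sD$, where $c_iD=\{c_id:d\in D\}$ and $\triangle$ is symmetric difference. Let $H_8=\{1,2,\ldots,8\}$, $H_8^{\nabla0}=\{1\}$ and $H_8^{\nabla k}=H_8^{\nabla(k-1)}\mathbin{\nabla}H_8$ for $k\geq1$. -}

module Defs where

open import Data.Nat using (ℕ; zero; suc; _*_; _≤?_; _+_)
open import Data.Nat.Properties using (_≟_)
open import Data.List using (List; []; _∷_; map; foldr; length; upTo)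
open import Relation.Nullary using (yes; no)

-- Finite sets of positive integers are represented as strictly increasing
-- lists of natural numbers (all operations below preserve this invariant
-- when applied to such lists).

toggle : ℕ → List ℕ → List ℕ
toggle x [] = x ∷ []
toggle x (y ∷ ys) with x ≟ y
... | yes _ = ys
... | no _ with x ≤? y
...   | yes _ = x ∷ y ∷ ys
...   | no _ = y ∷ toggle x ys

_△_ : List ℕ → List ℕ → List ℕ
X △ Y = foldr toggle X Y

dilate : ℕ → List ℕ → List ℕ
dilate c D = map (c *_) D

_∇_ : List ℕ → List ℕ → List ℕ
C ∇ D = foldr (λ c acc → dilate c D △ acc) [] C

H8 : List ℕ
H8 = map suc (upTo 8)

H8pow : ℕ → List ℕ
H8pow zero = 1 ∷ []
H8pow (suc k) = H8pow k ∇ H8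

∣_∣ : List ℕ → ℕ
∣ S ∣ = length S

-- Read a finite set S through its parity functional  g ↦ ⊕_{s ∈ S} g s  over GF(2).
-- The operation ∇ turns into composition of such functionals, and squaring the
-- functional of A is the functional of {a² : a ∈ A}: the cross terms f(ab) and f(ba)
-- cancel in pairs (Frobenius).  Hence H^{∇(4n+1)} has the same parity functional as
-- the multiset {y⁴h : y ∈ H^{∇n}, h ∈ H}.  When 0 < h < 16 for all h ∈ H, the
-- products y⁴h are pairwise distinct (a fourth power dividing h would be 1), so this
-- multiset is a set of size |H^{∇n}|·|H|, and a set is determined by its parity
-- functional.
module Submission where

open import Defs
open import Data.Bool using (Bool; true; false; _xor_)
open import Data.Bool.Properties using (¬-not; xor-assoc; xor-same; xor-identityʳ; xor-∧-commutativeRing)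
open import Data.Nat using (ℕ; zero; suc; _+_; _*_; _^_; _/_; _≤_; _<_; _≤?_; _<?_; z≤n; s≤s; NonZero; >-nonZero; ≢-nonZero; ≢-nonZero⁻¹)
open import Data.Nat.Properties
open import Data.Nat.Divisibility using (_∣_; divides; ∣⇒≤; ∣1⇒≡1; ∣-trans)
open import Data.Nat.Coprimality using (Coprime; coprime-divisor; coprime-/gcd)
import Data.Nat.Coprimality as Coprime
open import Data.Nat.GCD using (gcd; gcd[m,n]∣m; gcd[m,n]∣n; gcd[m,n]≢0; m/gcd[m,n]≢0; n/gcd[m,n]≢0)
open import Data.Nat.DivMod using (m/n*n≡m)
open import Data.Nat.Tactic.RingSolver using (solve-∀)
open import Data.List using (List; []; _∷_; map; foldr; _++_; length; cartesianProductWith)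
open import Data.List.Properties using (length-++; length-map)
open import Data.List.Relation.Unary.All as All using (All; []; _∷_; all?)
import Data.List.Relation.Unary.All.Properties as All
open import Data.List.Relation.Unary.AllPairs as AllPairs using ([]; _∷_)
open import Data.List.Relation.Unary.Any using (here; there)
open import Data.List.Relation.Unary.Linked as Linked using (Linked; [-]; _∷_; linked?)
open import Data.List.Relation.Unary.Linked.Properties using (Linked⇒AllPairs; map⁺)
open import Data.List.Relation.Unary.Unique.Propositional using (Unique)
open import Data.List.Relation.Unary.Unique.Propositional.Properties using (++⁺)
open import Data.List.Membership.Propositional using (_∈_)
open import Data.List.Membership.Propositional.Properties using (∈-map⁻; ∈-cartesianProductWith⁻)
open import Data.List.Membership.Propositional.Properties.WithK using (unique∧set⇒bag)
open import Data.List.Relation.Binary.BagAndSetEquality using (∼bag⇒↭)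
open import Data.List.Relation.Binary.Permutation.Propositional.Properties using (↭-length)
open import Data.Product using (_×_; _,_; proj₁; proj₂)
open import Data.Sum using (inj₁)
open import Data.Empty using (⊥-elim)
open import Function.Base using (_∘_)
open import Function.Bundles using (_⇔_; mk⇔; Equivalence)
open import Relation.Nullary using (yes; no; ¬_)
open import Relation.Nullary.Decidable using (⌊_⌋; from-yes)
open import Relation.Binary.PropositionalEquality
open import Algebra.Bundles using (CommutativeRing)
open import Algebra.Properties.CommutativeSemigroup
  (CommutativeRing.+-commutativeSemigroup xor-∧-commutativeRing) using (x∙yz≈y∙xz; interchange)

-- Parity functionals

parity : List ℕ → (ℕ → Bool) → Bool
parity S g = foldr (λ s b → g s xor b) false S

xor-cancelˡ : ∀ x y → x xor (x xor y) ≡ y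
xor-cancelˡ x y = trans (sym (xor-assoc x x y)) (cong (_xor y) (xor-same x))

parity-cong : ∀ S {g h} → g ≗ h → parity S g ≡ parity S h
parity-cong []       g≗h = refl
parity-cong (s ∷ ss) g≗h = cong₂ _xor_ (g≗h s) (parity-cong ss g≗h)

parity-xor : ∀ S g h → parity S (λ s → g s xor h s) ≡ parity S g xor parity S h
parity-xor []       g h = refl
parity-xor (s ∷ ss) g h = begin
  (g s xor h s) xor parity ss (λ t → g t xor h t) ≡⟨ cong ((g s xor h s) xor_) (parity-xor ss g h) ⟩
  (g s xor h s) xor (parity ss g xor parity ss h) ≡⟨ interchange (g s) (h s) _ _ ⟩
  (g s xor parity ss g) xor (h s xor parity ss h) ∎
  where open ≡-Reasoning

parity-++ : ∀ X Y g → parity (X ++ Y) g ≡ parity X g xor parity Y g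
parity-++ []       Y g = refl
parity-++ (x ∷ xs) Y g = trans (cong (g x xor_) (parity-++ xs Y g)) (sym (xor-assoc (g x) _ _))

parity-map : ∀ f D g → parity (map f D) g ≡ parity D (λ d → g (f d))
parity-map f []       g = refl
parity-map f (d ∷ ds) g = cong (g (f d) xor_) (parity-map f ds g)

parity-toggle : ∀ x S g → parity (toggle x S) g ≡ g x xor parity S g
parity-toggle x []       g = refl
parity-toggle x (y ∷ ys) g with x ≟ y
... | yes refl = sym (xor-cancelˡ (g x) (parity ys g))
... | no _ with x ≤? y
...   | yes _ = refl
...   | no _  = trans (cong (g y xor_) (parity-toggle x ys g)) (x∙yz≈y∙xz (g y) (g x) _)

parity-△ : ∀ X Y g → parity (X △ Y) g ≡ parity X g xor parity Y g
parity-△ X []       g = sym (xor-identityʳ (parity X g))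
parity-△ X (y ∷ ys) g = begin
  parity (toggle y (X △ ys)) g       ≡⟨ parity-toggle y (X △ ys) g ⟩
  g y xor parity (X △ ys) g          ≡⟨ cong (g y xor_) (parity-△ X ys g) ⟩
  g y xor (parity X g xor parity ys g) ≡⟨ x∙yz≈y∙xz (g y) (parity X g) (parity ys g) ⟩
  parity X g xor parity (y ∷ ys) g   ∎
  where open ≡-Reasoning

parity-∇ : ∀ C D g → parity (C ∇ D) g ≡ parity C (λ c → parity D (λ d → g (c * d)))
parity-∇ []       D g = refl
parity-∇ (c ∷ cs) D g = begin
  parity (dilate c D △ (cs ∇ D)) g                   ≡⟨ parity-△ (dilate c D) (cs ∇ D) g ⟩
  parity (dilate c D) g xor parity (cs ∇ D) g        ≡⟨ cong₂ _xor_ (parity-map (c *_) D g) (parity-∇ cs D g) ⟩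
  parity (c ∷ cs) (λ c → parity D (λ d → g (c * d))) ∎
  where open ≡-Reasoning

parity-cartesianProductWith : ∀ (f : ℕ → ℕ → ℕ) X Y g →
  parity (cartesianProductWith f X Y) g ≡ parity X (λ x → parity Y (λ y → g (f x y)))
parity-cartesianProductWith f []       Y g = refl
parity-cartesianProductWith f (x ∷ xs) Y g =
  trans (parity-++ (map (f x) Y) _ g)
        (cong₂ _xor_ (parity-map (f x) Y g) (parity-cartesianProductWith f xs Y g))

-- The cross terms f (a * b) and f (b * a) cancel.
parity-square : ∀ A (f : ℕ → Bool) → parity A (λ a → parity A (λ b → f (a * b))) ≡ parity A (λ a → f (a * a))
parity-square []       f = refl
parity-square (y ∷ ys) f = begin
  (f (y * y) xor P) xor parity ys (λ a → f (a * y) xor parity ys (λ b → f (a * b)))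
    ≡⟨ cong ((f (y * y) xor P) xor_) (parity-xor ys (λ a → f (a * y)) (λ a → parity ys (λ b → f (a * b)))) ⟩
  (f (y * y) xor P) xor (parity ys (λ a → f (a * y)) xor R)
    ≡⟨ cong (λ t → (f (y * y) xor P) xor (t xor R)) (parity-cong ys (λ a → cong f (*-comm a y))) ⟩
  (f (y * y) xor P) xor (P xor R)
    ≡⟨ xor-assoc (f (y * y)) P (P xor R) ⟩
  f (y * y) xor (P xor (P xor R))
    ≡⟨ cong (f (y * y) xor_) (trans (xor-cancelˡ P R) (parity-square ys f)) ⟩
  f (y * y) xor parity ys (λ a → f (a * a)) ∎
  where
  open ≡-Reasoning
  P R : Bool
  P = parity ys (λ b → f (y * b))
  R = parity ys (λ a → parity ys (λ b → f (a * b)))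

indicator : ℕ → ℕ → Bool
indicator z s = ⌊ z ≟ s ⌋

parity-indicator : ∀ {S} z → Unique S → z ∈ S ⇔ parity S (indicator z) ≡ true
parity-indicator {[]}     z []          = mk⇔ (λ ()) (λ ())
parity-indicator {y ∷ ys} z (y∉ys ∷ u) with z ≟ y | parity-indicator z u
... | yes refl | z∈ys⇔ = mk⇔ (λ _ → cong (true xor_) z∉ys) (λ _ → here refl)
  where
  z∉ys : parity ys (indicator z) ≡ false
  z∉ys = ¬-not (λ eq → All.lookup y∉ys (Equivalence.from z∈ys⇔ eq) refl)
... | no z≢y | z∈ys⇔ =
  mk⇔ (λ { (here z≡y) → ⊥-elim (z≢y z≡y) ; (there z∈ys) → Equivalence.to z∈ys⇔ z∈ys })
      (λ eq → there (Equivalence.from z∈ys⇔ eq))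

≡-parity⇒≡-length : ∀ {X Y} → Unique X → Unique Y → (∀ g → parity X g ≡ parity Y g) →
                    length X ≡ length Y
≡-parity⇒≡-length {X} {Y} uX uY X≡Y = ↭-length (∼bag⇒↭ (unique∧set⇒bag uX uY same-members))
  where
  same-members : ∀ {z} → z ∈ X ⇔ z ∈ Y
  same-members {z} = mk⇔
    (λ z∈X → from (parity-indicator z uY) (trans (sym (X≡Y (indicator z))) (to (parity-indicator z uX) z∈X)))
    (λ z∈Y → from (parity-indicator z uX) (trans (X≡Y (indicator z)) (to (parity-indicator z uY) z∈Y)))
    where open Equivalence

-- Canonical representation of finite sets

-- The leading 0 is a lower bound, not an element: it makes the elements positive.
Increasing : List ℕ → Set
Increasing xs = Linked _<_ (0 ∷ xs)

linked-lower : ∀ {a b xs} → a ≤ b → Linked _<_ (b ∷ xs) → Linked _<_ (a ∷ xs)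
linked-lower a≤b [-]         = [-]
linked-lower a≤b (b<x ∷ b∷xs) = ≤-<-trans a≤b b<x ∷ b∷xs

toggle-linked : ∀ {b x} S → b < x → Linked _<_ (b ∷ S) → Linked _<_ (b ∷ toggle x S)
toggle-linked         []       b<x [-]          = b<x ∷ [-]
toggle-linked {x = x} (y ∷ ys) b<x (b<y ∷ y∷ys) with x ≟ y
... | yes refl = linked-lower (<⇒≤ b<y) y∷ys
... | no x≢y with x ≤? y
...   | yes x≤y = b<x ∷ ≤∧≢⇒< x≤y x≢y ∷ y∷ys
...   | no x≰y  = b<y ∷ toggle-linked ys (≰⇒> x≰y) y∷ys

△-increasing : ∀ X Y → Increasing X → All (0 <_) Y → Increasing (X △ Y)
△-increasing X []       incX []         = incX
△-increasing X (y ∷ ys) incX (0<y ∷ 0<ys) = toggle-linked (X △ ys) 0<y (△-increasing X ys incX 0<ys)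

dilate-increasing : ∀ c .{{_ : NonZero c}} {D} → Increasing D → Increasing (dilate c D)
dilate-increasing c incD = linked-lower z≤n (map⁺ (Linked.map (*-monoʳ-< c) incD))

increasing⇒positive : ∀ {xs} → Increasing xs → All (0 <_) xs
increasing⇒positive incXs with Linked⇒AllPairs <-trans incXs
... | 0<xs ∷ _ = 0<xs

increasing⇒unique : ∀ {xs} → Increasing xs → Unique xs
increasing⇒unique incXs with Linked⇒AllPairs <-trans incXs
... | _ ∷ xs< = AllPairs.map <⇒≢ xs<

∇-increasing : ∀ C D → All (0 <_) C → Increasing D → Increasing (C ∇ D)
∇-increasing []       D []           incD = [-]
∇-increasing (c ∷ cs) D (0<c ∷ 0<cs) incD =
  △-increasing (dilate c D) (cs ∇ D) (dilate-increasing c {{>-nonZero 0<c}} incD)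
               (increasing⇒positive (∇-increasing cs D 0<cs incD))

private
  variable
    A B C : Set

map⁺-on : ∀ {f : A → B} {xs} → (∀ {x y} → x ∈ xs → y ∈ xs → f x ≡ f y → x ≡ y) →
          Unique xs → Unique (map f xs)
map⁺-on inj []          = []
map⁺-on inj (x∉xs ∷ u) =
  All.map⁺ (All.tabulate (λ y∈xs fx≡fy → All.lookup x∉xs y∈xs (inj (here refl) (there y∈xs) fx≡fy)))
  ∷ map⁺-on (λ x∈ y∈ → inj (there x∈) (there y∈)) u

cartesianProductWith⁺-on : ∀ (f : A → B → C) {xs ys} →
  (∀ {w x y z} → w ∈ xs → x ∈ xs → y ∈ ys → z ∈ ys → f w y ≡ f x z → w ≡ x × y ≡ z) →
  Unique xs → Unique ys → Unique (cartesianProductWith f xs ys)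
cartesianProductWith⁺-on f                inj []           uys = []
cartesianProductWith⁺-on f {x ∷ xs} {ys} inj (x∉xs ∷ uxs) uys =
  ++⁺ (map⁺-on (λ y∈ z∈ → proj₂ ∘ inj (here refl) (here refl) y∈ z∈) uys)
      (cartesianProductWith⁺-on f (λ w∈ x∈ → inj (there w∈) (there x∈)) uxs uys)
      disjoint
  where
  disjoint : ∀ {v} → ¬ (v ∈ map (f x) ys × v ∈ cartesianProductWith f xs ys)
  disjoint (v∈fx , v∈rest) with ∈-map⁻ (f x) v∈fx | ∈-cartesianProductWith⁻ f xs ys v∈rest
  ... | y , y∈ys , refl | w , z , w∈xs , z∈ys , fxy≡fwz =
    All.lookup x∉xs w∈xs (proj₁ (inj (here refl) (there w∈xs) y∈ys z∈ys fxy≡fwz))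

length-cartesianProductWith : ∀ (f : A → B → C) xs ys →
  length (cartesianProductWith f xs ys) ≡ length xs * length ys
length-cartesianProductWith f []       ys = refl
length-cartesianProductWith f (x ∷ xs) ys = begin
  length (map (f x) ys ++ cartesianProductWith f xs ys)    ≡⟨ length-++ (map (f x) ys) ⟩
  length (map (f x) ys) + length (cartesianProductWith f xs ys)
    ≡⟨ cong₂ _+_ (length-map (f x) ys) (length-cartesianProductWith f xs ys) ⟩
  length ys + length xs * length ys                           ∎
  where open ≡-Reasoning

-- Numbers of the form y ^ e * h with 0 < h < 2 ^ e

coprime-*ˡ : ∀ {m n o} → Coprime m o → Coprime n o → Coprime (m * n) o
coprime-*ˡ {m} m⊥o n⊥o (i∣mn , i∣o) = n⊥o (coprime-divisor i⊥m i∣mn , i∣o)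
  where
  i⊥m : Coprime _ m
  i⊥m (j∣i , j∣m) = m⊥o (j∣m , ∣-trans j∣i i∣o)

coprime-^ˡ : ∀ {m n} k → Coprime m n → Coprime (m ^ k) n
coprime-^ˡ zero    m⊥n (i∣1 , _) = ∣1⇒≡1 i∣1
coprime-^ˡ (suc k) m⊥n = coprime-*ˡ m⊥n (coprime-^ˡ k m⊥n)

coprime-^ : ∀ {m n} k → Coprime m n → Coprime (m ^ k) (n ^ k)
coprime-^ k m⊥n = Coprime.sym (coprime-^ˡ k (Coprime.sym (coprime-^ˡ k m⊥n)))

^-distribʳ-* : ∀ m n k → (m * n) ^ k ≡ m ^ k * n ^ k
^-distribʳ-* m n zero    = refl
^-distribʳ-* m n (suc k) = begin
  m * n * (m * n) ^ k       ≡⟨ cong (m * n *_) (^-distribʳ-* m n k) ⟩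
  m * n * (m ^ k * n ^ k)   ≡⟨ [m*n]*[o*p]≡[m*o]*[n*p] m n (m ^ k) (n ^ k) ⟩
  m * m ^ k * (n * n ^ k)   ∎
  where open ≡-Reasoning

-- b ^ e divides a ^ e * h, hence h, and so b ^ e ≤ h < 2 ^ e.
coprime-^-*≡⇒<2 : ∀ {a b h h'} e → Coprime a b → a ^ e * h ≡ b ^ e * h' → 0 < h → h < 2 ^ e → b < 2
coprime-^-*≡⇒<2 {a} {b} {h} {h'} e a⊥b eq 0<h h<2^e =
  ≰⇒> (λ 2≤b → <⇒≱ (≤-<-trans (∣⇒≤ {{>-nonZero 0<h}} bᵉ∣h) h<2^e) (^-monoˡ-≤ e 2≤b))
  where
  bᵉ∣h : b ^ e ∣ h
  bᵉ∣h = coprime-divisor (Coprime.sym (coprime-^ e a⊥b))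
                         (divides h' (trans eq (*-comm (b ^ e) h')))

^-*-injectiveˡ : ∀ {y y' h h'} e → 0 < y → 0 < y' → 0 < h → h < 2 ^ e → 0 < h' → h' < 2 ^ e →
                 y ^ e * h ≡ y' ^ e * h' → y ≡ y'
^-*-injectiveˡ {y} {y'} {h} {h'} e 0<y 0<y' 0<h h<2^e 0<h' h'<2^e eq = begin
  y         ≡⟨ sym (m/n*n≡m (gcd[m,n]∣m y y')) ⟩
  a * d     ≡⟨ cong (_* d) (trans a≡1 (sym b≡1)) ⟩
  b * d     ≡⟨ m/n*n≡m (gcd[m,n]∣n y y') ⟩
  y'        ∎
  where
  open ≡-Reasoning
  d a b : ℕ
  d = gcd y y'
  instance
    _ : NonZero d
    _ = ≢-nonZero (gcd[m,n]≢0 y y' (inj₁ (≢-nonZero⁻¹ y {{>-nonZero 0<y}})))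
  a = y / d
  b = y' / d
  factor : ∀ x k → (x / d * d) ^ e * k ≡ d ^ e * (x / d) ^ e * k
  factor x k = cong (_* k) (trans (^-distribʳ-* (x / d) d e) (*-comm ((x / d) ^ e) (d ^ e)))
  reduced : a ^ e * h ≡ b ^ e * h'
  reduced = *-cancelˡ-≡ _ _ (d ^ e) {{m^n≢0 d e}} (begin
    d ^ e * (a ^ e * h)  ≡⟨ sym (trans (factor y h) (*-assoc (d ^ e) _ h)) ⟩
    (a * d) ^ e * h     ≡⟨ cong (λ x → x ^ e * h) (m/n*n≡m (gcd[m,n]∣m y y')) ⟩
    y ^ e * h           ≡⟨ eq ⟩
    y' ^ e * h'         ≡⟨ cong (λ x → x ^ e * h') (sym (m/n*n≡m (gcd[m,n]∣n y y'))) ⟩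
    (b * d) ^ e * h'    ≡⟨ trans (factor y' h') (*-assoc (d ^ e) _ h') ⟩
    d ^ e * (b ^ e * h') ∎)
  a⊥b : Coprime a b
  a⊥b = coprime-/gcd y y'
  a≡1 : a ≡ 1
  a≡1 = ≤-antisym (≤-pred (coprime-^-*≡⇒<2 e (Coprime.sym a⊥b) (sym reduced) 0<h' h'<2^e))
                  (n≢0⇒n>0 (m/gcd[m,n]≢0 y y' {{>-nonZero 0<y}}))
  b≡1 : b ≡ 1
  b≡1 = ≤-antisym (≤-pred (coprime-^-*≡⇒<2 e a⊥b reduced 0<h h<2^e))
                  (n≢0⇒n>0 (n/gcd[m,n]≢0 y y' {{>-nonZero 0<y'}}))

-- Iterated ∇-powers

_∇^_ : List ℕ → ℕ → List ℕ
H ∇^ zero  = 1 ∷ []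
H ∇^ suc k = (H ∇^ k) ∇ H

H8pow≡H8∇^ : ∀ k → H8pow k ≡ H8 ∇^ k
H8pow≡H8∇^ zero    = refl
H8pow≡H8∇^ (suc k) = cong (_∇ H8) (H8pow≡H8∇^ k)

∇^-increasing : ∀ {H} → Increasing H → ∀ k → Increasing (H ∇^ k)
∇^-increasing incH zero    = s≤s z≤n ∷ [-]
∇^-increasing incH (suc k) =
  ∇-increasing _ _ (increasing⇒positive (∇^-increasing incH k)) incH

4n+1≡1+[2n+2n] : ∀ n → 4 * n + 1 ≡ suc ((n + n) + (n + n))
4n+1≡1+[2n+2n] = solve-∀

module _ (H : List ℕ) where

  parity-∇^-+ : ∀ j k g →
    parity (H ∇^ (j + k)) g ≡ parity (H ∇^ j) (λ x → parity (H ∇^ k) (λ y → g (x * y)))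
  parity-∇^-+ j zero g rewrite +-identityʳ j =
    parity-cong (H ∇^ j) (λ x → trans (cong g (sym (*-identityʳ x))) (sym (xor-identityʳ _)))
  parity-∇^-+ j (suc k) g rewrite +-suc j k = begin
    parity (H ∇^ suc (j + k)) g
      ≡⟨ parity-∇ (H ∇^ (j + k)) H g ⟩
    parity (H ∇^ (j + k)) (λ x → parity H (λ h → g (x * h)))
      ≡⟨ parity-∇^-+ j k (λ x → parity H (λ h → g (x * h))) ⟩
    parity (H ∇^ j) (λ x → parity (H ∇^ k) (λ y → parity H (λ h → g (x * y * h))))
      ≡⟨ parity-cong (H ∇^ j) (λ x → parity-cong (H ∇^ k) (λ y → parity-cong H (λ h → cong g (*-assoc x y h)))) ⟩
    parity (H ∇^ j) (λ x → parity (H ∇^ k) (λ y → parity H (λ h → g (x * (y * h)))))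
      ≡⟨ parity-cong (H ∇^ j) (λ x → sym (parity-∇ (H ∇^ k) H (λ y → g (x * y)))) ⟩
    parity (H ∇^ j) (λ x → parity (H ∇^ suc k) (λ y → g (x * y))) ∎
    where open ≡-Reasoning

  parity-∇^-double : ∀ j g → parity (H ∇^ (j + j)) g ≡ parity (H ∇^ j) (λ x → g (x ^ 2))
  parity-∇^-double j g = begin
    parity (H ∇^ (j + j)) g           ≡⟨ parity-∇^-+ j j g ⟩
    parity (H ∇^ j) (λ x → parity (H ∇^ j) (λ y → g (x * y))) ≡⟨ parity-square (H ∇^ j) g ⟩
    parity (H ∇^ j) (λ x → g (x * x)) ≡⟨ parity-cong (H ∇^ j) (λ x → cong (λ y → g (x * y)) (sym (*-identityʳ x))) ⟩
    parity (H ∇^ j) (λ x → g (x ^ 2)) ∎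
    where open ≡-Reasoning

  parity-∇^-4n+1 : ∀ n g →
    parity (H ∇^ (4 * n + 1)) g ≡ parity (cartesianProductWith (λ y h → y ^ 4 * h) (H ∇^ n) H) g
  parity-∇^-4n+1 n g rewrite 4n+1≡1+[2n+2n] n = begin
    parity (H ∇^ suc (2n + 2n)) g
      ≡⟨ parity-∇ (H ∇^ (2n + 2n)) H g ⟩
    parity (H ∇^ (2n + 2n)) (λ x → parity H (λ h → g (x * h)))
      ≡⟨ parity-∇^-double 2n (λ x → parity H (λ h → g (x * h))) ⟩
    parity (H ∇^ (n + n)) (λ x → parity H (λ h → g (x ^ 2 * h)))
      ≡⟨ parity-∇^-double n (λ x → parity H (λ h → g (x ^ 2 * h))) ⟩
    parity (H ∇^ n) (λ y → parity H (λ h → g ((y ^ 2) ^ 2 * h)))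
      ≡⟨ parity-cong (H ∇^ n) (λ y → parity-cong H (λ h → cong (λ z → g (z * h)) (^-*-assoc y 2 2))) ⟩
    parity (H ∇^ n) (λ y → parity H (λ h → g (y ^ 4 * h)))
      ≡⟨ sym (parity-cartesianProductWith (λ y h → y ^ 4 * h) (H ∇^ n) H g) ⟩
    parity (cartesianProductWith (λ y h → y ^ 4 * h) (H ∇^ n) H) g ∎
    where
    open ≡-Reasoning
    2n : ℕ
    2n = n + n

length-∇^-4n+1 : ∀ {H} → Increasing H → All (_< 2 ^ 4) H → ∀ n →
                 length (H ∇^ (4 * n + 1)) ≡ length (H ∇^ n) * length H
length-∇^-4n+1 {H} incH H<16 n = begin
  length (H ∇^ (4 * n + 1))
    ≡⟨ ≡-parity⇒≡-length (increasing⇒unique (∇^-increasing incH (4 * n + 1)))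
                         (cartesianProductWith⁺-on _ injective (increasing⇒unique incHⁿ) (increasing⇒unique incH))
                         (parity-∇^-4n+1 H n) ⟩
  length (cartesianProductWith (λ y h → y ^ 4 * h) (H ∇^ n) H)
    ≡⟨ length-cartesianProductWith _ (H ∇^ n) H ⟩
  length (H ∇^ n) * length H ∎
  where
  open ≡-Reasoning
  incHⁿ : Increasing (H ∇^ n)
  incHⁿ = ∇^-increasing incH n
  injective : ∀ {w x y z} → w ∈ H ∇^ n → x ∈ H ∇^ n → y ∈ H → z ∈ H →
              w ^ 4 * y ≡ x ^ 4 * z → w ≡ x × y ≡ z
  injective {w} {x} {y} {z} w∈ x∈ y∈ z∈ eq = w≡x , y≡z
    where
    positiveHⁿ : ∀ {v} → v ∈ H ∇^ n → 0 < v
    positiveHⁿ = All.lookup (increasing⇒positive incHⁿ)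
    positiveH : ∀ {v} → v ∈ H → 0 < v
    positiveH = All.lookup (increasing⇒positive incH)
    w≡x : w ≡ x
    w≡x = ^-*-injectiveˡ 4 (positiveHⁿ w∈) (positiveHⁿ x∈) (positiveH y∈) (All.lookup H<16 y∈)
                           (positiveH z∈) (All.lookup H<16 z∈) eq
    y≡z : y ≡ z
    y≡z = *-cancelˡ-≡ y z (w ^ 4) {{m^n≢0 w 4 {{>-nonZero (positiveHⁿ w∈)}}}}
                      (trans eq (cong (λ t → t ^ 4 * z) (sym w≡x)))

lemma11 : (m : ℕ) → ∣ H8pow (4 * suc m + 1) ∣ ≡ 8 * ∣ H8pow (suc m) ∣
lemma11 m = begin
  ∣ H8pow (4 * n + 1) ∣          ≡⟨ cong length (H8pow≡H8∇^ (4 * n + 1)) ⟩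
  length (H8 ∇^ (4 * n + 1))     ≡⟨ length-∇^-4n+1 H8-increasing H8<16 n ⟩
  length (H8 ∇^ n) * 8           ≡⟨ *-comm (length (H8 ∇^ n)) 8 ⟩
  8 * length (H8 ∇^ n)           ≡⟨ cong (λ S → 8 * length S) (sym (H8pow≡H8∇^ n)) ⟩
  8 * ∣ H8pow n ∣                ∎
  where
  open ≡-Reasoning
  n : ℕ
  n = suc m
  H8-increasing : Increasing H8
  H8-increasing = from-yes (linked? _<?_ (0 ∷ H8))
  H8<16 : All (_< 2 ^ 4) H8
  H8<16 = from-yes (all? (_<? 2 ^ 4) H8)
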